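{- Let $G$ be a finite simple graph and let $(A,B,K)$ be a partition of $V(G)$ such that $A$ is anticomplete to $B$ and $K$ is a clique. Assume that either $K=\{k\}$ for a single vertex $k$ that is not anticomplete to $A$, or no vertex of $B$ is complete to $K$. Let $H=G[A\cup K]$. If $S$ is a strong stable set of $G$, then $S\cap V(H)$ is a strong stable set of $H$. In particular, for a vertex $v\in K$: if $G$ has a strong stable set $S$ with $v\in S$ (respectively $v\notin S$), then $H$ has a strong stable set $S'$ with $v\in S'$ (respectively $v\notin S'$).
   Context: All graphs are finite and simple. $G[X]$ is the subgraph induced on $X$. Two disjoint vertex sets $X,Y$ are complete (anticomplete) to each other if every (no) vertex of $X$ is adjacent to a vertex of $Y$, i.e. all (none of the) pairs $x\in X$, $y\in Y$ are adjacent; a vertex $v$ is complete (anticomplete) to $X$ if $\{v\}$ is. A clique is a set of pairwise adjacent vertices; a maximal clique is a clique not contained in a larger clique. A strong stable set of a graph is a stable set that meets every nonempty maximal clique of the graph. -}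

module Defs where

open import Data.Nat using (ℕ)
open import Data.Fin using (Fin)
open import Data.Fin.Subset using (Subset; _∈_; _∉_; _⊆_; Nonempty; ⊤; _∪_)
open import Data.Product using (_×_; ∃; Σ; _,_)
open import Data.Sum using (_⊎_)
open import Relation.Nullary using (¬_; Dec)
open import Relation.Binary.PropositionalEquality using (_≡_; _≢_)

record Graph (n : ℕ) : Set₁ where
  field
    Adj     : Fin n → Fin n → Set
    adj?    : ∀ u v → Dec (Adj u v)
    symm    : ∀ {u v} → Adj u v → Adj v u
    irrefl  : ∀ {u} → ¬ Adj u u
open Graph public

module _ {n : ℕ} (G : Graph n) where

  -- Notions in the induced subgraph G[X], for a vertex set X ⊆ V(G).
  -- (For X = ⊤ these are the notions in G itself.)

  IsCliqueIn : Subset n → Subset n → Set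
  IsCliqueIn X C = C ⊆ X × (∀ u v → u ∈ C → v ∈ C → u ≢ v → Adj G u v)

  IsMaximalCliqueIn : Subset n → Subset n → Set
  IsMaximalCliqueIn X C = IsCliqueIn X C × (∀ D → IsCliqueIn X D → C ⊆ D → D ⊆ C)

  IsStableIn : Subset n → Subset n → Set
  IsStableIn X S = S ⊆ X × (∀ u v → u ∈ S → v ∈ S → ¬ Adj G u v)

  IsStrongStableIn : Subset n → Subset n → Set
  IsStrongStableIn X S =
    IsStableIn X S ×
    (∀ C → IsMaximalCliqueIn X C → Nonempty C → ∃ λ v → v ∈ C × v ∈ S)

  IsClique : Subset n → Set
  IsClique = IsCliqueIn ⊤

  IsStrongStable : Subset n → Set
  IsStrongStable = IsStrongStableIn ⊤

  Anticomplete : Subset n → Subset n → Set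
  Anticomplete X Y = ∀ x y → x ∈ X → y ∈ Y → ¬ Adj G x y

  CompleteTo : Fin n → Subset n → Set
  CompleteTo v Y = ∀ y → y ∈ Y → Adj G v y

  IsPartition₃ : Subset n → Subset n → Subset n → Set
  IsPartition₃ A B K = ∀ v →
      (v ∈ A × v ∉ B × v ∉ K)
    ⊎ (v ∉ A × v ∈ B × v ∉ K)
    ⊎ (v ∉ A × v ∉ B × v ∈ K)

-- A maximal clique C of H = G[A ∪ K] stays maximal in G unless some b ∈ B is
-- complete to C. Such a C would lie in K (A is anticomplete to B), hence equal K
-- by maximality; with no b complete to K this is impossible, and when K = {k} a
-- neighbour of k in A would extend C inside H. So every maximal clique of H is
-- one of G, and a strong stable set S of G meets it inside V(H).
module Submission where

open import Defs
open import Data.Nat using (ℕ)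
open import Data.Fin using (Fin)
open import Data.Fin.Subset using (Subset; _∈_; _∉_; _∩_; _∪_; ⁅_⁆; _⊆_; ⊤; Nonempty)
open import Data.Fin.Subset.Properties
  using (_∈?_; ∈⊤; x∈⁅x⁆; x∈⁅y⁆⇒x≡y; x∈p∩q⁺; p∩q⊆p; p∩q⊆q; x∈p∪q⁺; x∈p∪q⁻; p⊆p∪q; q⊆p∪q)
open import Data.Product using (_×_; ∃; Σ; _,_; proj₁)
open import Data.Sum using (_⊎_; inj₁; inj₂)
open import Data.Empty using (⊥-elim)
open import Function using (_∘_)
open import Relation.Nullary using (¬_; yes; no)
open import Relation.Binary.PropositionalEquality using (_≡_; _≢_; refl; sym; subst)

module _ {n : ℕ} (G : Graph n) where

  ∈-maximalClique : ∀ {X C a} → IsMaximalCliqueIn G X C → a ∈ X →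
    (∀ c → c ∈ C → c ≢ a → Adj G a c) → a ∈ C
  ∈-maximalClique {X} {C} {a} ((C⊆X , C-clique) , C-maximal) a∈X a-adj =
    C-maximal (C ∪ ⁅ a ⁆) (C∪a⊆X , C∪a-clique) (p⊆p∪q ⁅ a ⁆) (q⊆p∪q C ⁅ a ⁆ (x∈⁅x⁆ a))
    where
    ∈C∪a⁻ : ∀ {u} → u ∈ C ∪ ⁅ a ⁆ → u ∈ C ⊎ u ≡ a
    ∈C∪a⁻ u∈ with x∈p∪q⁻ C ⁅ a ⁆ u∈
    ... | inj₁ u∈C = inj₁ u∈C
    ... | inj₂ u∈a = inj₂ (x∈⁅y⁆⇒x≡y a u∈a)

    C∪a⊆X : C ∪ ⁅ a ⁆ ⊆ X
    C∪a⊆X u∈ with ∈C∪a⁻ u∈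
    ... | inj₁ u∈C = C⊆X u∈C
    ... | inj₂ refl = a∈X

    C∪a-clique : ∀ u v → u ∈ C ∪ ⁅ a ⁆ → v ∈ C ∪ ⁅ a ⁆ → u ≢ v → Adj G u v
    C∪a-clique u v u∈ v∈ u≢v with ∈C∪a⁻ u∈ | ∈C∪a⁻ v∈
    ... | inj₁ u∈C  | inj₁ v∈C  = C-clique u v u∈C v∈C u≢v
    ... | inj₁ u∈C  | inj₂ refl = symm G (a-adj u u∈C u≢v)
    ... | inj₂ refl | inj₁ v∈C  = a-adj v v∈C (u≢v ∘ sym)
    ... | inj₂ refl | inj₂ refl = ⊥-elim (u≢v refl)

  maximalCliqueIn⇒maximalClique : ∀ {X C} → IsMaximalCliqueIn G X C →
    (∀ d → d ∉ X → ¬ CompleteTo G d C) → IsMaximalCliqueIn G ⊤ C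
  maximalCliqueIn⇒maximalClique {X} {C} C-max@((C⊆X , C-clique) , _) noneComplete =
    ((λ _ → ∈⊤) , C-clique) , C-maximal
    where
    C-maximal : ∀ D → IsClique G D → C ⊆ D → D ⊆ C
    C-maximal D (_ , D-clique) C⊆D {d} d∈D with d ∈? X
    ... | yes d∈X = ∈-maximalClique C-max d∈X d-adj
      where
      d-adj : ∀ c → c ∈ C → c ≢ d → Adj G d c
      d-adj c c∈C c≢d = D-clique d c d∈D (C⊆D c∈C) (c≢d ∘ sym)
    ... | no d∉X = ⊥-elim (noneComplete d d∉X d-complete)
      where
      d-complete : CompleteTo G d C
      d-complete c c∈C = D-clique d c d∈D (C⊆D c∈C) λ { refl → d∉X (C⊆X c∈C) }

  ∈-maximalClique-⊆⁅⁆ : ∀ {X C k a} → IsMaximalCliqueIn G X C → C ⊆ ⁅ k ⁆ → a ∈ X →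
    Adj G k a → a ∈ C
  ∈-maximalClique-⊆⁅⁆ {C = C} {k} {a} C-max C⊆⁅k⁆ a∈X k~a = ∈-maximalClique C-max a∈X a-adj
    where
    a-adj : ∀ c → c ∈ C → c ≢ a → Adj G a c
    a-adj c c∈C _ = subst (Adj G a) (sym (x∈⁅y⁆⇒x≡y k (C⊆⁅k⁆ c∈C))) (symm G k~a)

  strongStable-∩ : ∀ {X S} → (∀ C → IsMaximalCliqueIn G X C → IsMaximalCliqueIn G ⊤ C) →
    IsStrongStable G S → IsStrongStableIn G X (S ∩ X)
  strongStable-∩ {X} {S} maximal⇒maximal ((_ , S-stable) , S-meets) =
    (p∩q⊆q S X , λ u v u∈ v∈ → S-stable u v (p∩q⊆p S X u∈) (p∩q⊆p S X v∈)) , meets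
    where
    meets : ∀ C → IsMaximalCliqueIn G X C → Nonempty C → ∃ λ v → v ∈ C × v ∈ S ∩ X
    meets C C-max C≠∅ with S-meets C (maximal⇒maximal C C-max) C≠∅
    ... | v , v∈C , v∈S = v , v∈C , x∈p∩q⁺ (v∈S , proj₁ (proj₁ C-max) v∈C)

module _ {n : ℕ} (G : Graph n) (A B K : Subset n) (partition : IsPartition₃ G A B K) where

  ∈A⇒∉K : ∀ {x} → x ∈ A → x ∉ K
  ∈A⇒∉K {x} x∈A with partition x
  ... | inj₁ (_ , _ , x∉K)        = x∉K
  ... | inj₂ (inj₁ (x∉A , _))     = ⊥-elim (x∉A x∈A)
  ... | inj₂ (inj₂ (x∉A , _))     = ⊥-elim (x∉A x∈A)

  ∉A∪K⇒∈B : ∀ {x} → x ∉ A ∪ K → x ∈ B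
  ∉A∪K⇒∈B {x} x∉A∪K with partition x
  ... | inj₁ (x∈A , _)            = ⊥-elim (x∉A∪K (x∈p∪q⁺ (inj₁ x∈A)))
  ... | inj₂ (inj₁ (_ , x∈B , _)) = x∈B
  ... | inj₂ (inj₂ (_ , _ , x∈K)) = ⊥-elim (x∉A∪K (x∈p∪q⁺ (inj₂ x∈K)))

  completeFromB⇒⊆K : Anticomplete G A B → ∀ {C b} → C ⊆ A ∪ K → b ∈ B →
    CompleteTo G b C → C ⊆ K
  completeFromB⇒⊆K A≁B C⊆A∪K b∈B b-complete {c} c∈C with x∈p∪q⁻ A K (C⊆A∪K c∈C)
  ... | inj₁ c∈A = ⊥-elim (A≁B c _ c∈A b∈B (symm G (b-complete c c∈C)))
  ... | inj₂ c∈K = c∈K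

  noVertexComplete-maximalClique :
    Anticomplete G A B → IsClique G K →
    ((Σ (Fin n) λ k → K ≡ ⁅ k ⁆ × ¬ Anticomplete G ⁅ k ⁆ A)
      ⊎ (∀ b → b ∈ B → ¬ CompleteTo G b K)) →
    ∀ {C} → IsMaximalCliqueIn G (A ∪ K) C → ∀ d → d ∉ A ∪ K → ¬ CompleteTo G d C
  noVertexComplete-maximalClique A≁B (_ , K-clique) hyp {C} C-max@((C⊆A∪K , _) , C-maximal)
    d d∉A∪K d-complete
    with hyp | completeFromB⇒⊆K A≁B C⊆A∪K (∉A∪K⇒∈B d∉A∪K) d-complete
  ... | inj₁ (k , K≡⁅k⁆ , ¬k≁A) | C⊆K = ¬k≁A k≁A
    where
    k≁A : Anticomplete G ⁅ k ⁆ A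
    k≁A x a x∈⁅k⁆ a∈A x~a = ∈A⇒∉K a∈A (C⊆K (∈-maximalClique-⊆⁅⁆ G C-max
      (subst (λ Y → C ⊆ Y) K≡⁅k⁆ C⊆K) (x∈p∪q⁺ (inj₁ a∈A))
      (subst (λ y → Adj G y a) (x∈⁅y⁆⇒x≡y k x∈⁅k⁆) x~a)))
  ... | inj₂ noneCompleteToK | C⊆K =
    noneCompleteToK d (∉A∪K⇒∈B d∉A∪K) (λ k k∈K → d-complete k (K⊆C k∈K))
    where
    K⊆C : K ⊆ C
    K⊆C = C-maximal K ((λ k∈K → x∈p∪q⁺ (inj₂ k∈K)) , K-clique) C⊆K

lemma2p1 : ∀ {n : ℕ} (G : Graph n) (A B K : Subset n) →
    IsPartition₃ G A B K →
    Anticomplete G A B →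
    IsClique G K →
    ((Σ (Fin n) λ k → K ≡ ⁅ k ⁆ × ¬ Anticomplete G ⁅ k ⁆ A)
      ⊎ (∀ b → b ∈ B → ¬ CompleteTo G b K)) →
    ((S : Subset n) → IsStrongStable G S → IsStrongStableIn G (A ∪ K) (S ∩ (A ∪ K)))
    × (∀ v → v ∈ K →
        ((∃ λ S → IsStrongStable G S × v ∈ S) →
           ∃ λ S′ → IsStrongStableIn G (A ∪ K) S′ × v ∈ S′)
        × ((∃ λ S → IsStrongStable G S × v ∉ S) →
           ∃ λ S′ → IsStrongStableIn G (A ∪ K) S′ × v ∉ S′))
lemma2p1 {n} G A B K partition A≁B K-clique hyp =
  restrict , λ v v∈K →
      (λ (S , S-strong , v∈S) → S ∩ (A ∪ K) , restrict S S-strong , x∈p∩q⁺ (v∈S , x∈p∪q⁺ (inj₂ v∈K)))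
    , (λ (S , S-strong , v∉S) → S ∩ (A ∪ K) , restrict S S-strong , v∉S ∘ p∩q⊆p S (A ∪ K))
  where
  maximal⇒maximal : ∀ C → IsMaximalCliqueIn G (A ∪ K) C → IsMaximalCliqueIn G ⊤ C
  maximal⇒maximal C C-max = maximalCliqueIn⇒maximalClique G C-max
    (noVertexComplete-maximalClique G A B K partition A≁B K-clique hyp C-max)

  restrict : (S : Subset n) → IsStrongStable G S → IsStrongStableIn G (A ∪ K) (S ∩ (A ∪ K))
  restrict S = strongStable-∩ G maximal⇒maximal
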